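{- Let $m\geq 3$. Then the graph $\mathrm{Cay}(\mathbb{Z}_m\times\mathbb{Z}_{16},\ \{\pm1\}\times\{8\})\cup mI_{13}\cup mI_{14}\cup mI_{15}$ can be decomposed into two $C_{16}$-factors and a $1$-factor.
   Context: For a finite additive group $\Gamma$ and $S\subseteq\Gamma\setminus\{0\}$ closed under negatives, $\mathrm{Cay}(\Gamma,S)$ has vertex set $\Gamma$ and an edge between $a,b$ whenever $a-b\in S$; here $S=\{(1,8),(-1,8)\}\subseteq \mathbb{Z}_m\times\mathbb{Z}_{16}$. The following are perfect matchings of $K_{16}$ on vertex set $\mathbb{Z}_{16}$: $I_{13}=\{(0,9),(6,12),(5,2),(11,8),(14,7),(4,13),(15,1),(3,10)\}$, $I_{14}=\{(9,6),(12,5),(2,11),(8,14),(7,4),(13,15),(1,3),(10,0)\}$, $I_{15}=\{(0,11),(13,2),(12,7),(14,9),(3,5),(10,4),(15,6),(1,8)\}$. For such a matching $I_k$, $mI_k$ denotes the graph with vertex set $\mathbb{Z}_m\times\mathbb{Z}_{16}$ and edge set $\{\{(j,a),(j,b)\}: j\in\mathbb{Z}_m,\ (a,b)\in I_k\}$. The union of graphs on the same vertex set has the union of their edge sets. A $C_{16}$-factor is a spanning subgraph each of whose components is a 16-cycle; a $1$-factor is a perfect matching; decomposing means partitioning the edge set into these factors. -}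

module Defs where

open import Data.Nat using (ℕ; zero; suc; _≡ᵇ_; _≤_)
open import Data.Nat.DivMod using (_%_)
open import Data.Fin using (Fin; toℕ; fromℕ<) renaming (zero to fzero)
open import Data.Nat.DivMod using (m%n<n)
open import Data.Bool using (Bool; true; false; _∨_; _∧_; if_then_else_)
open import Data.Product using (_×_; _,_; Σ; ∃)
open import Data.Sum using (_⊎_)
open import Data.List using (List; []; _∷_)
open import Data.Bool.ListAction using (any)
open import Function.Definitions using (Injective)
open import Relation.Binary.PropositionalEquality using (_≡_)

V : ℕ → Set
V m = Fin m × Fin 16

Graph : ℕ → Set
Graph m = V m → V m → Bool

sucMod : ℕ → ℕ → ℕ
sucMod k x = if suc x ≡ᵇ k then 0 else suc x

plus8 : ℕ → ℕ
plus8 x = (x Data.Nat.+ 8) % 16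

-- Cay(Z_m × Z_16, {(1,8),(-1,8)}):  (j,a) ~ (j',b)  iff  (j,a)-(j',b) ∈ S,
-- i.e. j' = j ± 1 (mod m) and b = a + 8 (mod 16)  (note -8 = 8 in Z_16).
cay : (m : ℕ) → Graph m
cay m (j , a) (j' , b) =
  ((toℕ j' ≡ᵇ sucMod m (toℕ j)) ∨ (toℕ j ≡ᵇ sucMod m (toℕ j')))
  ∧ (toℕ b ≡ᵇ plus8 (toℕ a))

Matching : Set
Matching = List (ℕ × ℕ)

inPairs : Matching → ℕ → ℕ → Bool
inPairs I a b = any (λ { (x , y) → ((x ≡ᵇ a) ∧ (y ≡ᵇ b)) ∨ ((x ≡ᵇ b) ∧ (y ≡ᵇ a)) }) I

copies : (m : ℕ) → Matching → Graph m
copies m I (j , a) (j' , b) = (toℕ j ≡ᵇ toℕ j') ∧ inPairs I (toℕ a) (toℕ b)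

I13 I14 I15 : Matching
I13 = (0 , 9) ∷ (6 , 12) ∷ (5 , 2) ∷ (11 , 8) ∷ (14 , 7) ∷ (4 , 13) ∷ (15 , 1) ∷ (3 , 10) ∷ []
I14 = (9 , 6) ∷ (12 , 5) ∷ (2 , 11) ∷ (8 , 14) ∷ (7 , 4) ∷ (13 , 15) ∷ (1 , 3) ∷ (10 , 0) ∷ []
I15 = (0 , 11) ∷ (13 , 2) ∷ (12 , 7) ∷ (14 , 9) ∷ (3 , 5) ∷ (10 , 4) ∷ (15 , 6) ∷ (1 , 8) ∷ []

_∪_ : {m : ℕ} → Graph m → Graph m → Graph m
(G ∪ H) u v = G u v ∨ H u v

theGraph : (m : ℕ) → Graph m
theGraph m = cay m ∪ (copies m I13 ∪ (copies m I14 ∪ copies m I15))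

_⊆_ : {m : ℕ} → Graph m → Graph m → Set
_⊆_ {m} H G = ∀ (u v : V m) → H u v ≡ true → G u v ≡ true

Symmetric : {m : ℕ} → Graph m → Set
Symmetric {m} H = ∀ (u v : V m) → H u v ≡ H v u

IsOneFactor : {m : ℕ} → Graph m → Set
IsOneFactor {m} H = Symmetric H × (∀ (u : V m) → Σ (V m) λ v →
  (H u v ≡ true) × (∀ (w : V m) → H u w ≡ true → w ≡ v))

next prev : Fin 16 → Fin 16
next i = fromℕ< {(toℕ i Data.Nat.+ 1) % 16} (m%n<n (toℕ i Data.Nat.+ 1) 16)
prev i = fromℕ< {(toℕ i Data.Nat.+ 15) % 16} (m%n<n (toℕ i Data.Nat.+ 15) 16)

-- C_16-factor: spanning subgraph in which the component of every vertex u
-- is a 16-cycle: there is an injective cyclic sequence f of 16 vertices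
-- starting at u, consecutive ones adjacent in H, and every H-neighbour of
-- f i is f (i+1) or f (i-1) (so the component is exactly this cycle).
IsC16Factor : {m : ℕ} → Graph m → Set
IsC16Factor {m} H = Symmetric H × (∀ (u : V m) → Σ (Fin 16 → V m) λ f →
    (f fzero ≡ u)
  × Injective _≡_ _≡_ f
  × (∀ (i : Fin 16) → H (f i) (f (next i)) ≡ true)
  × (∀ (i : Fin 16) (w : V m) → H (f i) w ≡ true → (w ≡ f (next i)) ⊎ (w ≡ f (prev i))))

b2n : Bool → ℕ
b2n true = 1
b2n false = 0

-- G decomposes into the edge-disjoint union of H₁, H₂, H₃:
-- every edge of G lies in exactly one Hᵢ and every edge of each Hᵢ is in G.
DecomposesInto : {m : ℕ} → Graph m → Graph m → Graph m → Graph m → Set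
DecomposesInto {m} G H₁ H₂ H₃ = ∀ (u v : V m) →
  b2n (H₁ u v) Data.Nat.+ b2n (H₂ u v) Data.Nat.+ b2n (H₃ u v) ≡ b2n (G u v)

-- Give every layer {j} × Z₁₆ a type so that consecutive layers are compatible: around Z_m the
-- types read a₀ a₁ a₀ a₁ … when m is even and a₀ g₁ g₂ a₀ a₁ … a₀ a₁ when m is odd.  The type
-- of a layer decides which factor receives each of its three inner matchings and the Cayley edges
-- to the next layer.  Every factor then splits into blocks of one layer, or of two consecutive
-- layers joined by their Cayley edges, and inside a block it is the union of two of the
-- matchings I13, I14, I15, x ↦ x + 8 (the cycle factors) or a single one of them (the 1-factor).
-- A block is determined by the types of its two layers, so only finitely many blocks occur, and
-- each one is checked by evaluation to be a union of 16-cycles, resp. a perfect matching.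
module Submission where

open import Defs
open import Data.Bool using (Bool; true; false; not; _∧_; _∨_; if_then_else_)
open import Data.Bool.ListAction using (any)
import Data.Bool.Properties as Bool
open import Data.Empty using (⊥-elim)
open import Data.Fin using (Fin; toℕ; fromℕ<; fromℕ; inject₁) renaming (zero to fzero; suc to fsuc)
import Data.Fin.Properties as Fin
open import Data.List using (List; []; _∷_)
open import Data.Nat using (ℕ; zero; suc; _≡ᵇ_; _+_; _≤_; _<_; s≤s; z<s)
open import Data.Nat.DivMod using (_mod_)
import Data.Nat.Properties as ℕ
open import Data.Product using (Σ; ∃; _×_; _,_; proj₁; proj₂)
open import Data.Product.Properties using (≡-dec)
open import Data.Sum using (_⊎_; inj₁; inj₂)
import Data.Sum as Sum
open import Data.Vec using (Vec; lookup) renaming ([] to []ᵛ; _∷_ to _∷ᵛ_)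
open import Function using (id; _∘_; Equivalence)
open import Function.Definitions using (Injective)
open import Relation.Binary.Definitions using (DecidableEquality)
open import Relation.Binary.PropositionalEquality
  using (_≡_; _≢_; refl; sym; trans; cong; cong₂; module ≡-Reasoning)
open import Relation.Nullary using (Dec; yes; no)
open import Relation.Nullary.Decidable using (dec-true; dec-false; map′; _×-dec_; _⊎-dec_; _→-dec_; from-yes)
open import Relation.Unary using (Decidable)

≡ᵇ-true : ∀ x y → x ≡ y → (x ≡ᵇ y) ≡ true
≡ᵇ-true x y = dec-true (x ℕ.≟ y)

≡ᵇ-false : ∀ x y → x ≢ y → (x ≡ᵇ y) ≡ false
≡ᵇ-false x y = dec-false (x ℕ.≟ y)

≡ᵇ-sound : ∀ x y → (x ≡ᵇ y) ≡ true → x ≡ y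
≡ᵇ-sound x y e = ℕ.≡ᵇ⇒≡ x y (Equivalence.from Bool.T-≡ e)

≡ᵇ-sym : ∀ x y → (x ≡ᵇ y) ≡ (y ≡ᵇ x)
≡ᵇ-sym zero    zero    = refl
≡ᵇ-sym zero    (suc y) = refl
≡ᵇ-sym (suc x) zero    = refl
≡ᵇ-sym (suc x) (suc y) = ≡ᵇ-sym x y

all-Bool? : {P : Bool → Set} → Decidable P → Dec (∀ d → P d)
all-Bool? P? = map′ (λ { (p , q) true → p ; (p , q) false → q }) (λ h → h true , h false) (P? true ×-dec P? false)

IsCycle16 : {A : Set} → (A → A → Bool) → (Fin 16 → A) → Set
IsCycle16 {A} G f = Injective _≡_ _≡_ f
  × (∀ i → G (f i) (f (next i)) ≡ true)
  × (∀ i (w : A) → G (f i) w ≡ true → (w ≡ f (next i)) ⊎ (w ≡ f (prev i)))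

UniqueNeighbour : {A : Set} → (A → A → Bool) → A → A → Set
UniqueNeighbour G x y = G x y ≡ true × (∀ z → G x z ≡ true → z ≡ y)

module Embedding {A B : Set} (G : A → A → Bool) (H : B → B → Bool) (ι : A → B)
                 (ι-injective : Injective _≡_ _≡_ ι) (ι-preserves : ∀ x y → H (ι x) (ι y) ≡ G x y) where

  NeighboursInside : A → Set
  NeighboursInside x = ∀ w → H (ι x) w ≡ true → ∃ λ y → w ≡ ι y

  neighbour-preimage : ∀ {x w} → NeighboursInside x → H (ι x) w ≡ true → ∃ λ y → w ≡ ι y × G x y ≡ true
  neighbour-preimage {x} inside e with inside _ e
  ... | y , refl = y , refl , trans (sym (ι-preserves x y)) e

  cycle-transfer : ∀ f → IsCycle16 G f → (∀ i → NeighboursInside (f i)) → IsCycle16 H (ι ∘ f)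
  cycle-transfer f (f-injective , f-adjacent , f-neighbours) inside =
    f-injective ∘ ι-injective ,
    (λ i → trans (ι-preserves (f i) (f (next i))) (f-adjacent i)) ,
    λ i w e → let y , w≡ιy , Gy = neighbour-preimage (inside i) e in
      Sum.map (trans w≡ιy ∘ cong ι) (trans w≡ιy ∘ cong ι) (f-neighbours i y Gy)

  uniqueNeighbour-transfer : ∀ {x y} → UniqueNeighbour G x y → NeighboursInside x →
    UniqueNeighbour H (ι x) (ι y)
  uniqueNeighbour-transfer {x} {y} (Gxy , unique) inside =
    trans (ι-preserves x y) Gxy ,
    λ w e → let z , w≡ιz , Gz = neighbour-preimage inside e in trans w≡ιz (cong ι (unique z Gz))

sucMod-wrap : ∀ n → sucMod (suc n) n ≡ 0
sucMod-wrap n rewrite ≡ᵇ-true n n refl = refl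

sucMod-step : ∀ {m x} → suc x ≢ m → sucMod m x ≡ suc x
sucMod-step {m} {x} ne rewrite ≡ᵇ-false (suc x) m ne = refl

sucMod-< : ∀ {m x} → x < m → sucMod m x < m
sucMod-< {m} {x} x<m with ℕ.m≤n⇒m<n∨m≡n x<m
... | inj₁ 1+x<m rewrite sucMod-step (ℕ.<⇒≢ 1+x<m) = 1+x<m
... | inj₂ refl  rewrite sucMod-wrap x = z<s

sucMod-≢ : ∀ {m x} → 2 ≤ m → sucMod m x ≢ x
sucMod-≢ {m} {x} 2≤m with suc x ℕ.≟ m
... | yes refl rewrite sucMod-wrap x = λ { refl → ℕ.<-irrefl refl 2≤m }
... | no 1+x≢m rewrite sucMod-step 1+x≢m = ℕ.1+n≢n

sucMod²-≢ : ∀ {m x} → 3 ≤ m → sucMod m (sucMod m x) ≢ x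
sucMod²-≢ {m} {x} 3≤m with suc x ℕ.≟ m
sucMod²-≢ {m} {x} 3≤m | yes refl rewrite sucMod-wrap x with 1 ℕ.≟ suc x
... | yes refl = λ _ → ℕ.<-irrefl refl (ℕ.≤-trans (ℕ.n≤1+n 2) 3≤m)
... | no 1≢m rewrite sucMod-step 1≢m = λ { refl → ℕ.<-irrefl refl 3≤m }
sucMod²-≢ {m} {x} 3≤m | no 1+x≢m rewrite sucMod-step 1+x≢m with suc (suc x) ℕ.≟ m
... | yes refl rewrite sucMod-wrap (suc x) = λ { refl → ℕ.<-irrefl refl 3≤m }
... | no 2+x≢m rewrite sucMod-step 2+x≢m = λ e → ℕ.<⇒≢ (ℕ.m<n⇒m<1+n (ℕ.n<1+n x)) (sym e)

sucMod-injective : ∀ {m x y} → sucMod m x ≡ sucMod m y → x ≡ y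
sucMod-injective {m} {x} {y} e with suc x ℕ.≟ m | suc y ℕ.≟ m
... | yes refl | yes 1+y≡m = ℕ.suc-injective (sym 1+y≡m)
... | yes refl | no 1+y≢m rewrite sucMod-wrap x | sucMod-step 1+y≢m with e
...   | ()
sucMod-injective {m} {x} {y} e | no 1+x≢m | yes refl rewrite sucMod-wrap y | sucMod-step 1+x≢m with e
...   | ()
sucMod-injective {m} {x} {y} e | no 1+x≢m | no 1+y≢m
  rewrite sucMod-step 1+x≢m | sucMod-step 1+y≢m = ℕ.suc-injective e

up : ∀ {m} → Fin m → Fin m
up j = fromℕ< (sucMod-< (Fin.toℕ<n j))

toℕ-up : ∀ {m} (j : Fin m) → toℕ (up j) ≡ sucMod m (toℕ j)
toℕ-up j = Fin.toℕ-fromℕ< _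

up-injective : ∀ {m} {j j' : Fin m} → up j ≡ up j' → j ≡ j'
up-injective {m} {j} {j'} e =
  Fin.toℕ-injective (sucMod-injective {m} (trans (sym (toℕ-up j)) (trans (cong toℕ e) (toℕ-up j'))))

down : ∀ {m} → Fin m → Fin m
down {suc n} fzero    = fromℕ n
down {suc n} (fsuc i) = inject₁ i

up-down : ∀ {m} (j : Fin m) → up (down j) ≡ j
up-down {suc n} fzero = Fin.toℕ-injective (begin
    toℕ (up (fromℕ n))             ≡⟨ toℕ-up (fromℕ n) ⟩
    sucMod (suc n) (toℕ (fromℕ n)) ≡⟨ cong (sucMod (suc n)) (Fin.toℕ-fromℕ n) ⟩
    sucMod (suc n) n               ≡⟨ sucMod-wrap n ⟩
    0                              ∎)
  where open ≡-Reasoning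
up-down {suc n} (fsuc i) = Fin.toℕ-injective (begin
    toℕ (up (inject₁ i))             ≡⟨ toℕ-up (inject₁ i) ⟩
    sucMod (suc n) (toℕ (inject₁ i)) ≡⟨ cong (sucMod (suc n)) (Fin.toℕ-inject₁ i) ⟩
    sucMod (suc n) (toℕ i)           ≡⟨ sucMod-step (ℕ.<⇒≢ (s≤s (Fin.toℕ<n i))) ⟩
    suc (toℕ i)                      ∎)
  where open ≡-Reasoning

data LayerType : Set where
  a₀ a₁ g₁ g₂ : LayerType

all-LayerType? : {P : LayerType → Set} → Decidable P → Dec (∀ t → P t)
all-LayerType? P? = map′
  (λ { (p , q , r , s) a₀ → p ; (p , q , r , s) a₁ → q ; (p , q , r , s) g₁ → r ; (p , q , r , s) g₂ → s })
  (λ h → h a₀ , h a₁ , h g₁ , h g₂)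
  (P? a₀ ×-dec P? a₁ ×-dec P? g₁ ×-dec P? g₂)

follows : LayerType → LayerType → Bool
follows a₀ a₁ = true
follows a₀ g₁ = true
follows a₁ a₀ = true
follows g₁ g₂ = true
follows g₂ a₀ = true
follows _  _  = false

isEven : ℕ → Bool
isEven zero    = true
isEven (suc n) = not (isEven n)

alternating : ℕ → LayerType
alternating n = if isEven n then a₀ else a₁

withGadget : ℕ → LayerType
withGadget 0 = a₀
withGadget 1 = g₁
withGadget 2 = g₂
withGadget (suc (suc (suc n))) = alternating n

layerPattern : ℕ → ℕ → LayerType
layerPattern m = if isEven m then alternating else withGadget

layerType : ∀ {m} → Fin m → LayerType
layerType {m} j = layerPattern m (toℕ j)

alternating-follows : ∀ n → follows (alternating n) (alternating (suc n)) ≡ true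
alternating-follows n with isEven n
... | true  = refl
... | false = refl

withGadget-follows : ∀ n → follows (withGadget n) (withGadget (suc n)) ≡ true
withGadget-follows 0 = refl
withGadget-follows 1 = refl
withGadget-follows 2 = refl
withGadget-follows (suc (suc (suc n))) = alternating-follows n

layerPattern-follows-step : ∀ m n → follows (layerPattern m n) (layerPattern m (suc n)) ≡ true
layerPattern-follows-step m n with isEven m
... | true  = alternating-follows n
... | false = withGadget-follows n

layerPattern-start : ∀ m → layerPattern m 0 ≡ a₀
layerPattern-start m with isEven m
... | true  = refl
... | false = refl

withGadget-follows-wrap : ∀ n → 1 ≤ n → isEven n ≡ true → follows (withGadget n) a₀ ≡ true
withGadget-follows-wrap 1 _ ()
withGadget-follows-wrap 2 _ _ = refl
withGadget-follows-wrap (suc (suc (suc n))) _ even with isEven n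
withGadget-follows-wrap (suc (suc (suc n))) _ ()   | true
withGadget-follows-wrap (suc (suc (suc n))) _ even | false = refl

layerPattern-follows-wrap : ∀ n → 1 ≤ n → follows (layerPattern (suc n) n) a₀ ≡ true
layerPattern-follows-wrap n 1≤n with isEven n in even
... | false rewrite even = refl
... | true  = withGadget-follows-wrap n 1≤n even

layerPattern-follows : ∀ {m x} → 2 ≤ m → x < m →
  follows (layerPattern m x) (layerPattern m (sucMod m x)) ≡ true
layerPattern-follows {m} {x} 2≤m x<m with ℕ.m≤n⇒m<n∨m≡n x<m
... | inj₁ 1+x<m rewrite sucMod-step (ℕ.<⇒≢ 1+x<m) = layerPattern-follows-step m x
... | inj₂ refl rewrite sucMod-wrap x | layerPattern-start (suc x) =
  layerPattern-follows-wrap x (ℕ.≤-pred 2≤m)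

layerType-follows : ∀ {m} → 2 ≤ m → (j : Fin m) → follows (layerType j) (layerType (up j)) ≡ true
layerType-follows 2≤m j rewrite toℕ-up j = layerPattern-follows 2≤m (Fin.toℕ<n j)

data Offset : Set where
  same forward backward apart : Offset

opposite : Offset → Offset
opposite forward  = backward
opposite backward = forward
opposite o        = o

Flags : Set
Flags = Bool × Bool × Bool

layerFlags : ∀ {m} → Fin m → Fin m → Flags
layerFlags {m} j j' = (toℕ j ≡ᵇ toℕ j') , (toℕ j' ≡ᵇ sucMod m (toℕ j)) , (toℕ j ≡ᵇ sucMod m (toℕ j'))

flags : Offset → Flags
flags same     = true  , false , false
flags forward  = false , true  , false
flags backward = false , false , true
flags apart    = false , false , false

classify : Flags → Offset
classify (true  , _     , _    ) = same
classify (false , true  , _    ) = forward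
classify (false , false , true ) = backward
classify (false , false , false) = apart

offset : ∀ {m} → Fin m → Fin m → Offset
offset j j' = classify (layerFlags j j')

reverse : Flags → Flags
reverse (s , p , q) = s , q , p

flags-classify : ∀ {s p q} → (s ≡ true → p ≡ false) → (s ≡ true → q ≡ false) → (p ≡ true → q ≡ false) →
  (s , p , q) ≡ flags (classify (s , p , q))
flags-classify {true}                  s⇒¬p s⇒¬q _    rewrite s⇒¬p refl | s⇒¬q refl = refl
flags-classify {false} {true}          _    _    p⇒¬q rewrite p⇒¬q refl = refl
flags-classify {false} {false} {true}  _    _    _    = refl
flags-classify {false} {false} {false} _    _    _    = refl

classify-reverse-flags : ∀ o → classify (reverse (flags o)) ≡ opposite o
classify-reverse-flags same     = refl
classify-reverse-flags forward  = refl
classify-reverse-flags backward = refl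
classify-reverse-flags apart    = refl

layerFlags-reverse : ∀ {m} (j j' : Fin m) → layerFlags j' j ≡ reverse (layerFlags j j')
layerFlags-reverse j j' = cong (_, layerFlags j' j .proj₂) (≡ᵇ-sym (toℕ j') (toℕ j))

data Factor : Set where
  cycles₁ cycles₂ matching : Factor

-- The matchings of a layer of type t that belong to factor k, and whether factor k owns the
-- Cayley edges leaving (crossOut) or entering (crossIn) a layer of type t.
inner : Factor → LayerType → List Matching
inner cycles₁ g₁ = I13 ∷ []
inner cycles₁ g₂ = I13 ∷ []
inner cycles₁ _  = I13 ∷ I14 ∷ []
inner cycles₂ g₂ = I14 ∷ I15 ∷ []
inner cycles₂ _  = I15 ∷ []
inner matching g₁ = I14 ∷ []
inner matching _  = []

crossOut : Factor → LayerType → Bool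
crossOut cycles₁ g₁ = true
crossOut cycles₂ a₀ = true
crossOut matching a₁ = true
crossOut matching g₂ = true
crossOut _ _ = false

crossIn : Factor → LayerType → Bool
crossIn cycles₁ g₂ = true
crossIn cycles₂ a₁ = true
crossIn cycles₂ g₁ = true
crossIn matching a₀ = true
crossIn _ _ = false

CrossingConsistent : Factor → Set
CrossingConsistent k = ∀ t t' → follows t t' ≡ true → crossOut k t ≡ crossIn k t'

crossingConsistent? : ∀ k → Dec (CrossingConsistent k)
crossingConsistent? k = all-LayerType? λ t → all-LayerType? λ t' →
  (follows t t' Bool.≟ true) →-dec (crossOut k t Bool.≟ crossIn k t')

crossing-consistent : ∀ k → CrossingConsistent k
crossing-consistent cycles₁  = from-yes (crossingConsistent? cycles₁)
crossing-consistent cycles₂  = from-yes (crossingConsistent? cycles₂)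
crossing-consistent matching = from-yes (crossingConsistent? matching)

innerEdge : Factor → LayerType → Fin 16 → Fin 16 → Bool
innerEdge k t a b = any (λ I → inPairs I (toℕ a) (toℕ b)) (inner k t)

shifted : Fin 16 → Fin 16 → Bool
shifted a b = toℕ b ≡ᵇ plus8 (toℕ a)

-- Backward edges also test b = a + 8, since −8 = 8 in Z₁₆.
piece : Factor → Offset → LayerType → LayerType → Fin 16 → Fin 16 → Bool
piece k same     t _  a b = innerEdge k t a b
piece k forward  t _  a b = crossOut k t ∧ shifted a b
piece k backward _ t' a b = crossOut k t' ∧ shifted a b
piece k apart    _ _  _ _ = false

factor : Factor → (m : ℕ) → Graph m
factor k m (j , a) (j' , b) = piece k (offset j j') (layerType j) (layerType j') a b

edgesAt : Flags → Fin 16 → Fin 16 → Bool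
edgesAt (s , p , q) a b = ((p ∨ q) ∧ shifted a b) ∨
  ((s ∧ inPairs I13 (toℕ a) (toℕ b)) ∨ ((s ∧ inPairs I14 (toℕ a) (toℕ b)) ∨ (s ∧ inPairs I15 (toℕ a) (toℕ b))))

Partitions : Offset → LayerType → LayerType → Fin 16 → Fin 16 → Set
Partitions o t t' a b =
  b2n (piece cycles₁ o t t' a b) + b2n (piece cycles₂ o t t' a b) + b2n (piece matching o t t' a b)
  ≡ b2n (edgesAt (flags o) a b)

partitions? : ∀ o t t' a b → Dec (Partitions o t t' a b)
partitions? o t t' a b = _ ℕ.≟ _

pieces-partition : ∀ o t t' a b → Partitions o t t' a b
pieces-partition same     t t' = from-yes (all-LayerType? λ t → Fin.all? λ a → Fin.all? (partitions? same t t a)) t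
pieces-partition forward  t t' = from-yes (all-LayerType? λ t → Fin.all? λ a → Fin.all? (partitions? forward t t a)) t
pieces-partition backward t t' = from-yes (all-LayerType? λ t → Fin.all? λ a → Fin.all? (partitions? backward t t a)) t'
pieces-partition apart    t t' a b = refl

shifted-sym : ∀ a b → shifted a b ≡ shifted b a
shifted-sym = from-yes (Fin.all? λ a → Fin.all? λ b → shifted a b Bool.≟ shifted b a)

inPairs-sym : ∀ I a b → inPairs I a b ≡ inPairs I b a
inPairs-sym []            a b = refl
inPairs-sym ((x , y) ∷ I) a b = cong₂ _∨_ (Bool.∨-comm ((x ≡ᵇ a) ∧ (y ≡ᵇ b)) _) (inPairs-sym I a b)

innerEdge-sym : ∀ k t a b → innerEdge k t a b ≡ innerEdge k t b a
innerEdge-sym k t a b = go (inner k t)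
  where
  go : ∀ Is → any (λ I → inPairs I (toℕ a) (toℕ b)) Is ≡ any (λ I → inPairs I (toℕ b) (toℕ a)) Is
  go []       = refl
  go (I ∷ Is) = cong₂ _∨_ (inPairs-sym I (toℕ a) (toℕ b)) (go Is)

piece-opposite : ∀ k o t t' a b → (o ≡ same → t ≡ t') → piece k o t t' a b ≡ piece k (opposite o) t' t b a
piece-opposite k same     t t' a b t≡t' rewrite t≡t' refl = innerEdge-sym k t' a b
piece-opposite k forward  t t' a b _ = cong (crossOut k t ∧_) (shifted-sym a b)
piece-opposite k backward t t' a b _ = cong (crossOut k t' ∧_) (shifted-sym a b)
piece-opposite k apart    t t' a b _ = refl

-- A block consists of two consecutive layers b, b + 1; the Bool selects one of them.
Block : Set
Block = Bool × Fin 16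

_≟-Block_ : DecidableEquality Block
_≟-Block_ = ≡-dec Bool._≟_ Fin._≟_

all-Block? : {P : Block → Set} → Decidable P → Dec (∀ x → P x)
all-Block? P? = map′ (λ h (d , a) → h d a) (λ h d a → h (d , a)) (all-Bool? λ d → Fin.all? λ a → P? (d , a))

isCycle16? : (G : Block → Block → Bool) (f : Fin 16 → Block) → Dec (IsCycle16 G f)
isCycle16? G f = map′
  (λ { (injective , adjacent , neighbours) → (λ {i} {i'} → injective i i') , adjacent , neighbours })
  (λ { (injective , adjacent , neighbours) → (λ i i' → injective {i} {i'}) , adjacent , neighbours })
  ((Fin.all? λ i → distinct? i (f i))
   ×-dec (Fin.all? λ i → G (f i) (f (next i)) Bool.≟ true)
   ×-dec (Fin.all? λ i → neighbours? (f i) (f (next i)) (f (prev i))))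
  where
  -- f i is passed as an argument so that evaluation computes it only once
  distinct? : ∀ i x → Dec (∀ i' → x ≡ f i' → i ≡ i')
  distinct? i x = Fin.all? λ i' → (x ≟-Block f i') →-dec (i Fin.≟ i')
  neighbours? : ∀ x y z → Dec (∀ w → G x w ≡ true → (w ≡ y) ⊎ (w ≡ z))
  neighbours? x y z = all-Block? λ w → (G x w Bool.≟ true) →-dec ((w ≟-Block y) ⊎-dec (w ≟-Block z))

uniqueNeighbour? : (G : Block → Block → Bool) (x y : Block) → Dec (UniqueNeighbour G x y)
uniqueNeighbour? G x y = (G x y Bool.≟ true) ×-dec all-Block? λ z → (G x z Bool.≟ true) →-dec (z ≟-Block y)

offsetWithin : Bool → Bool → Offset
offsetWithin false true  = forward
offsetWithin true  false = backward
offsetWithin _     _     = same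

blockGraph : Factor → LayerType → LayerType → Block → Block → Bool
blockGraph k t₁ t₂ (d , a) (d' , b) =
  piece k (offsetWithin d d') (if d then t₂ else t₁) (if d' then t₂ else t₁) a b

-- A layer is the first layer of its block of factor k unless k owns its incoming Cayley edges;
-- then it is the second layer of the block of its predecessor.
Admissible : Factor → LayerType → LayerType → Bool → Bool
Admissible k t₁ t₂ d = follows t₁ t₂ ∧ (if d then crossIn k t₂ else not (crossIn k t₁))

Sealed : Factor → LayerType → LayerType → Bool → Set
Sealed k t₁ t₂ d = (if d then crossOut k t₂ else crossIn k t₁) ≡ false

sealed? : ∀ k t₁ t₂ d → Dec (Sealed k t₁ t₂ d)
sealed? k t₁ t₂ d = _ Bool.≟ false

mate : Matching → Fin 16 → Fin 16
mate I a = partnerIn I (toℕ a) mod 16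
  where
  partnerIn : Matching → ℕ → ℕ
  partnerIn []            a = a
  partnerIn ((x , y) ∷ I) a = if x ≡ᵇ a then y else if y ≡ᵇ a then x else partnerIn I a

within : Matching → Block → Block
within I (d , a) = d , mate I a

jump : Block → Block
jump (d , a) = not d , plus8 (toℕ a) mod 16

-- The two matchings whose alternation traces the cycles of factor k in a block whose first
-- layer has type t (the last clause covers types that never start a block of k).
moves : Factor → LayerType → (Block → Block) × (Block → Block)
moves cycles₁ a₀ = within I13 , within I14
moves cycles₁ a₁ = within I13 , within I14
moves cycles₁ g₁ = jump , within I13
moves cycles₂ a₀ = jump , within I15
moves cycles₂ g₂ = within I14 , within I15
moves _       _  = id , id

zigzag : {A : Set} → (A → A) → (A → A) → A → (n : ℕ) → Vec A n
zigzag σ τ x zero    = []ᵛ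
zigzag σ τ x (suc n) = x ∷ᵛ zigzag τ σ (σ x) n

walk : Factor → LayerType → Block → Fin 16 → Block
walk k t x = lookup (zigzag (proj₁ (moves k t)) (proj₂ (moves k t)) x 16)

partner : LayerType → Block → Block
partner g₁ = within I14
partner _  = jump

BlockCycles : Factor → Set
BlockCycles k = ∀ t₁ t₂ d a → Admissible k t₁ t₂ d ≡ true →
  IsCycle16 (blockGraph k t₁ t₂) (walk k t₁ (d , a)) × (∀ i → Sealed k t₁ t₂ (proj₁ (walk k t₁ (d , a) i)))

blockCycles? : ∀ k → Dec (BlockCycles k)
blockCycles? k = all-LayerType? λ t₁ → all-LayerType? λ t₂ → all-Bool? λ d → Fin.all? λ a →
  (Admissible k t₁ t₂ d Bool.≟ true) →-dec
  (isCycle16? (blockGraph k t₁ t₂) (walk k t₁ (d , a)) ×-dec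
   Fin.all? λ i → sealed? k t₁ t₂ (proj₁ (walk k t₁ (d , a) i)))

BlockMatching : Set
BlockMatching = ∀ t₁ t₂ d a → Admissible matching t₁ t₂ d ≡ true →
  UniqueNeighbour (blockGraph matching t₁ t₂) (d , a) (partner t₁ (d , a)) × Sealed matching t₁ t₂ d

blockMatching? : Dec BlockMatching
blockMatching? = all-LayerType? λ t₁ → all-LayerType? λ t₂ → all-Bool? λ d → Fin.all? λ a →
  (Admissible matching t₁ t₂ d Bool.≟ true) →-dec
  (uniqueNeighbour? (blockGraph matching t₁ t₂) (d , a) (partner t₁ (d , a)) ×-dec sealed? matching t₁ t₂ d)

cycles₁-blocks : BlockCycles cycles₁
cycles₁-blocks = from-yes (blockCycles? cycles₁)

cycles₂-blocks : BlockCycles cycles₂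
cycles₂-blocks = from-yes (blockCycles? cycles₂)

matching-blocks : BlockMatching
matching-blocks = from-yes blockMatching?

module _ {m : ℕ} (3≤m : 3 ≤ m) where

  private
    2≤m : 2 ≤ m
    2≤m = ℕ.≤-trans (ℕ.n≤1+n 2) 3≤m

  layerFlags-offset : ∀ (j j' : Fin m) → layerFlags j j' ≡ flags (offset j j')
  layerFlags-offset j j' = flags-classify same⇒¬forward same⇒¬backward forward⇒¬backward
    where
    same⇒¬forward : (toℕ j ≡ᵇ toℕ j') ≡ true → (toℕ j' ≡ᵇ sucMod m (toℕ j)) ≡ false
    same⇒¬forward s = ≡ᵇ-false (toℕ j') (sucMod m (toℕ j)) λ p →
      sucMod-≢ 2≤m (trans (sym p) (sym (≡ᵇ-sound (toℕ j) (toℕ j') s)))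
    same⇒¬backward : (toℕ j ≡ᵇ toℕ j') ≡ true → (toℕ j ≡ᵇ sucMod m (toℕ j')) ≡ false
    same⇒¬backward s = ≡ᵇ-false (toℕ j) (sucMod m (toℕ j')) λ q →
      sucMod-≢ 2≤m (trans (sym q) (≡ᵇ-sound (toℕ j) (toℕ j') s))
    forward⇒¬backward : (toℕ j' ≡ᵇ sucMod m (toℕ j)) ≡ true → (toℕ j ≡ᵇ sucMod m (toℕ j')) ≡ false
    forward⇒¬backward p = ≡ᵇ-false (toℕ j) (sucMod m (toℕ j')) λ q →
      sucMod²-≢ 3≤m (trans (cong (sucMod m) (sym (≡ᵇ-sound (toℕ j') (sucMod m (toℕ j)) p))) (sym q))

  offset-opposite : ∀ (j j' : Fin m) → offset j' j ≡ opposite (offset j j')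
  offset-opposite j j' = begin
    classify (layerFlags j' j)               ≡⟨ cong classify (layerFlags-reverse j j') ⟩
    classify (reverse (layerFlags j j'))     ≡⟨ cong (classify ∘ reverse) (layerFlags-offset j j') ⟩
    classify (reverse (flags (offset j j'))) ≡⟨ classify-reverse-flags (offset j j') ⟩
    opposite (offset j j')                   ∎
    where open ≡-Reasoning

  offset-same : ∀ {j j' : Fin m} → offset j j' ≡ same → j ≡ j'
  offset-same {j} {j'} o≡same = Fin.toℕ-injective
    (≡ᵇ-sound (toℕ j) (toℕ j') (cong proj₁ (trans (layerFlags-offset j j') (cong flags o≡same))))

  offset-forward : ∀ {j j' : Fin m} → offset j j' ≡ forward → j' ≡ up j
  offset-forward {j} {j'} o≡forward = Fin.toℕ-injective (trans
    (≡ᵇ-sound (toℕ j') (sucMod m (toℕ j))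
      (cong (proj₁ ∘ proj₂) (trans (layerFlags-offset j j') (cong flags o≡forward))))
    (sym (toℕ-up j)))

  offset-backward : ∀ {j j' : Fin m} → offset j j' ≡ backward → j ≡ up j'
  offset-backward {j} {j'} o≡backward = offset-forward (trans (offset-opposite j j') (cong opposite o≡backward))

  offset-refl : ∀ (j : Fin m) → offset j j ≡ same
  offset-refl j = cong (λ s → classify (s , layerFlags j j .proj₂)) (≡ᵇ-true (toℕ j) (toℕ j) refl)

  offset-up : ∀ (j : Fin m) → offset j (up j) ≡ forward
  offset-up j = cong₂ (λ s p → classify (s , p , layerFlags j (up j) .proj₂ .proj₂))
    (≡ᵇ-false (toℕ j) (toℕ (up j)) λ e → sucMod-≢ 2≤m (trans (sym (toℕ-up j)) (sym e)))
    (≡ᵇ-true (toℕ (up j)) (sucMod m (toℕ j)) (toℕ-up j))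

  theGraph-offset : ∀ (j j' : Fin m) a b → theGraph m (j , a) (j' , b) ≡ edgesAt (flags (offset j j')) a b
  theGraph-offset j j' a b = cong (λ f → edgesAt f a b) (layerFlags-offset j j')

  decomposition : DecomposesInto (theGraph m) (factor cycles₁ m) (factor cycles₂ m) (factor matching m)
  decomposition (j , a) (j' , b) = trans
    (pieces-partition (offset j j') (layerType j) (layerType j') a b)
    (cong b2n (sym (theGraph-offset j j' a b)))

  factor-symmetric : ∀ k → Symmetric (factor k m)
  factor-symmetric k (j , a) (j' , b) = trans
    (piece-opposite k (offset j j') (layerType j) (layerType j') a b (cong layerType ∘ offset-same))
    (cong (λ o → piece k o (layerType j') (layerType j) b a) (sym (offset-opposite j j')))

  lay : Fin m → Bool → Fin m
  lay b false = b
  lay b true  = up b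

  embed : Fin m → Block → V m
  embed b (d , a) = lay b d , a

  up≢ : ∀ (j : Fin m) → up j ≢ j
  up≢ j e = sucMod-≢ 2≤m (trans (sym (toℕ-up j)) (cong toℕ e))

  embed-injective : ∀ b {x y} → embed b x ≡ embed b y → x ≡ y
  embed-injective b {false , a} {false , a'} refl = refl
  embed-injective b {true  , a} {true  , a'} refl = refl
  embed-injective b {false , a} {true  , a'} e = ⊥-elim (up≢ b (sym (cong proj₁ e)))
  embed-injective b {true  , a} {false , a'} e = ⊥-elim (up≢ b (cong proj₁ e))

  offset-lay : ∀ b d d' → offset (lay b d) (lay b d') ≡ offsetWithin d d'
  offset-lay b false false = offset-refl b
  offset-lay b false true  = offset-up b
  offset-lay b true  false = trans (offset-opposite b (up b)) (cong opposite (offset-up b))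
  offset-lay b true  true  = offset-refl (up b)

  layerType-lay : ∀ b d → layerType (lay b d) ≡ (if d then layerType (up b) else layerType b)
  layerType-lay b false = refl
  layerType-lay b true  = refl

  embed-preserves : ∀ k b x y →
    factor k m (embed b x) (embed b y) ≡ blockGraph k (layerType b) (layerType (up b)) x y
  embed-preserves k b (d , a) (d' , a')
    rewrite offset-lay b d d' | layerType-lay b d | layerType-lay b d' = refl

  module BlockEmbedding (k : Factor) (b : Fin m) =
    Embedding (blockGraph k (layerType b) (layerType (up b))) (factor k m) (embed b)
              (embed-injective b) (embed-preserves k b)

  sealed-inside : ∀ k b d a → Sealed k (layerType b) (layerType (up b)) d →
    BlockEmbedding.NeighboursInside k b (d , a)
  sealed-inside k b d a sealed (j' , c) e with offset (lay b d) j' in o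
  sealed-inside k b d a sealed (j' , c) () | apart
  sealed-inside k b d a sealed (j' , c) e  | same = (d , c) , cong (_, c) (sym (offset-same o))
  sealed-inside k b false a sealed (j' , c) e | forward = (true , c) , cong (_, c) (offset-forward o)
  sealed-inside k b true  a sealed (j' , c) e | forward =
    ⊥-elim (Bool.not-¬ (Bool.∧-conicalˡ _ _ e) sealed)
  sealed-inside k b true  a sealed (j' , c) e | backward =
    (false , c) , cong (_, c) (sym (up-injective (offset-backward o)))
  sealed-inside k b false a sealed (j' , c) e | backward = ⊥-elim (Bool.not-¬ entering sealed)
    where
    entering : crossIn k (layerType b) ≡ true
    entering = begin
      crossIn k (layerType b)        ≡⟨ cong (crossIn k ∘ layerType) (offset-backward o) ⟩
      crossIn k (layerType (up j'))  ≡⟨ sym (crossing-consistent k _ _ (layerType-follows 2≤m j')) ⟩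
      crossOut k (layerType j')      ≡⟨ Bool.∧-conicalˡ _ _ e ⟩
      true                           ∎
      where open ≡-Reasoning

  blockOf : ∀ k (j : Fin m) →
    ∃ λ ((b , d) : Fin m × Bool) → lay b d ≡ j × Admissible k (layerType b) (layerType (up b)) d ≡ true
  blockOf k j with crossIn k (layerType j) in entered
  ... | true  = (down j , true) , up-down j ,
                cong₂ _∧_ (layerType-follows 2≤m (down j)) (trans (cong (crossIn k ∘ layerType) (up-down j)) entered)
  ... | false = (j , false) , refl , cong₂ _∧_ (layerType-follows 2≤m j) (cong not entered)

  cycle-factor : ∀ k → BlockCycles k → IsC16Factor (factor k m)
  cycle-factor k blocks = factor-symmetric k , cycleThrough
    where
    cycleThrough : ∀ u → Σ (Fin 16 → V m) λ f → f fzero ≡ u × IsCycle16 (factor k m) f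
    cycleThrough (j , a) with blockOf k j
    ... | (b , d) , refl , admissible =
      let cycle , sealed = blocks (layerType b) (layerType (up b)) d a admissible in
      embed b ∘ walk k (layerType b) (d , a) , refl ,
      BlockEmbedding.cycle-transfer k b _ cycle (λ i → sealed-inside k b _ _ (sealed i))

  matching-factor : IsOneFactor (factor matching m)
  matching-factor = factor-symmetric matching , partnerOf
    where
    partnerOf : ∀ u → ∃ (UniqueNeighbour (factor matching m) u)
    partnerOf (j , a) with blockOf matching j
    ... | (b , d) , refl , admissible =
      let unique , sealed = matching-blocks (layerType b) (layerType (up b)) d a admissible in
      embed b (partner (layerType b) (d , a)) ,
      BlockEmbedding.uniqueNeighbour-transfer matching b {d , a} unique (sealed-inside matching b d a sealed)

lemma2p11 : (m : ℕ) → 3 ≤ m →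
    Σ (Graph m) λ H₁ → Σ (Graph m) λ H₂ → Σ (Graph m) λ H₃ →
      DecomposesInto (theGraph m) H₁ H₂ H₃
      × IsC16Factor H₁ × IsC16Factor H₂ × IsOneFactor H₃
lemma2p11 m 3≤m =
  factor cycles₁ m , factor cycles₂ m , factor matching m ,
  decomposition 3≤m ,
  cycle-factor 3≤m cycles₁ cycles₁-blocks ,
  cycle-factor 3≤m cycles₂ cycles₂-blocks ,
  matching-factor 3≤m
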